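{- Let $G_1,\ldots,G_n$ be nondeterministic automata, where $G_i$ has set of secret states $Q_i^S$, and consider the composed system $G_1\|\cdots\|G_n$ with interaction $\|_\lor$, i.e. with set of secret states $Q^S=Q\setminus(Q_1^{NS}\times\cdots\times Q_n^{NS})$, $Q_i^{NS}=Q_i\setminus Q_i^S$. Let $\sim$ be an opaque observation equivalence on $G_1$ and $\tilde G_1$ the quotient automaton of $G_1$ modulo $\sim$. Then $G_1\|\cdots\|G_n$ is infinite-step opaque if and only if $\tilde G_1\|G_2\|\cdots\|G_n$ is infinite-step opaque (with secret states defined in the same $\|_\lor$ manner).
   Context: An automaton is $G=\langle\Sigma_\tau,Q,\to,Q^\circ\rangle$ with finite set $\Sigma$ of observable events, a special unobservable event $\tau\notin\Sigma$, $\Sigma_\tau=\Sigma\cup\{\tau\}$, finite states $Q$, transitions $\to\subseteq Q\times\Sigma_\tau\times Q$, initial states $Q^\circ$; it carries secret states $Q^S\subseteq Q$ and $Q^{NS}=Q\setminus Q^S$. For $s\in\Sigma^*$, $p\stackrel{s}{\Rightarrow}q$ means there is $t\in\Sigma_\tau^*$ which becomes $s$ after deleting all $\tau$'s and $p\stackrel{t}{\to}q$; $p\stackrel{s}{\Rightarrow}$ means $p\stackrel{s}{\Rightarrow}q$ for some $q$; $L(G,q)=\{s\in\Sigma^*:q\stackrel{s}{\Rightarrow}\}$. Synchronous composition: states are tuples, initial states products of initial states; an event in $\Sigma$ shared by components is executed jointly by all components having it in their alphabet; other events (including $\tau$, never shared) are executed by a single component while the others stay put. Infinite-step opacity: $G$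 is infinite-step opaque w.r.t. $Q^S$ iff for every $q^\circ\in Q^\circ$ and all $s,t\in\Sigma^*$ with $st\in L(G,q^\circ)$ and $q^\circ\stackrel{s}{\Rightarrow}Q^S$, there exist $q'^\circ\in Q^\circ$ and $y\in Q^{NS}$ with $q'^\circ\stackrel{s}{\Rightarrow}y$ and $y\stackrel{t}{\Rightarrow}$. Opaque observation equivalence: an equivalence relation $\sim$ on $Q$ such that whenever $x_1\sim x_2$: (i) if $x_1\stackrel{s}{\Rightarrow}y_1$ for some $s\in\Sigma^*$, then there is $y_2$ with $x_2\stackrel{s}{\Rightarrow}y_2$ and $y_1\sim y_2$; (ii) $x_1\in Q^S$ iff $x_2\in Q^S$. Quotient automaton modulo $\sim$: states are the classes $[x]$, $([x],\sigma,[y])$ is a transition iff $x'\stackrel{\sigma}{\to}y'$ for some $x'\in[x]$, $y'\in[y]$, initial states $\{[x^\circ]:x^\circ\in Q^\circ\}$; a class $[x]$ is secret iff $x\in Q^S$. -}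

module Defs where

open import Data.Nat using (ℕ; zero; suc)
open import Data.Fin using (Fin; zero; suc)
open import Data.Bool using (Bool; true; false; not; if_then_else_)
open import Data.List using (List; []; _∷_; _++_; allFin)
open import Data.Bool.ListAction using (any)
open import Data.Maybe using (Maybe; just; nothing)
open import Data.Product using (Σ; ∃; ∃-syntax; _×_; _,_)
open import Relation.Nullary using (¬_)
open import Relation.Binary using (IsEquivalence)
open import Relation.Binary.PropositionalEquality using (_≡_)
open import Function.Bundles using (_↔_)

Finite : Set → Set
Finite A = ∃[ k ] (Fin k ↔ A)

-- Labels: `just e` is an observable event e ∈ E, `nothing` is the unobservable τ.
Label : Set → Set
Label E = Maybe E

-- A nondeterministic automaton over a universe E of observable events,
-- with its own alphabet Σ ⊆ E (as a Boolean predicate), transition relation,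
-- initial states and secret states (Q^S given by `secret q ≡ true`,
-- so Q^NS = { q | secret q ≡ false }).
record Automaton (E : Set) : Set₁ where
  field
    State  : Set
    alph   : E → Bool
    Trans  : State → Label E → State → Set
    Init   : State → Set
    secret : State → Bool
open Automaton public

WellFormed : ∀ {E} → Automaton E → Set
WellFormed {E} G = ∀ {x : State G} {e : E} {y : State G} → Trans G x (just e) y → alph G e ≡ true

erase : ∀ {E : Set} → List (Label E) → List E
erase [] = []
erase (nothing ∷ t) = erase t
erase (just e ∷ t) = e ∷ erase t

data Path {E : Set} (G : Automaton E) : State G → List (Label E) → State G → Set where
  nil  : ∀ {p} → Path G p [] p
  cons : ∀ {p σ q t r} → Trans G p σ q → Path G q t r → Path G p (σ ∷ t) r

Weak : ∀ {E : Set} (G : Automaton E) → State G → List E → State G → Set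
Weak G p s q = ∃[ t ] (erase t ≡ s × Path G p t q)

Enabled : ∀ {E : Set} (G : Automaton E) → State G → List E → Set
Enabled G p s = ∃[ q ] Weak G p s q

InfiniteStepOpaque : ∀ {E : Set} → Automaton E → Set
InfiniteStepOpaque G =
  ∀ (q₀ : State G) (s t : List _) →
    Init G q₀ →
    Enabled G q₀ (s ++ t) →
    (∃[ q ] (Weak G q₀ s q × secret G q ≡ true)) →
    ∃[ q₀' ] ∃[ y ] (Init G q₀' × Weak G q₀' s y × secret G y ≡ false × Enabled G y t)

record IsOpaqueObsEquiv {E : Set} (G : Automaton E) (_∼_ : State G → State G → Set) : Set where
  field
    isEquivalence : IsEquivalence _∼_
    simulate      : ∀ {x₁ x₂ y₁ s} → x₁ ∼ x₂ → Weak G x₁ s y₁ →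
                    ∃[ y₂ ] (Weak G x₂ s y₂ × y₁ ∼ y₂)
    secretResp    : ∀ {x₁ x₂} → x₁ ∼ x₂ → secret G x₁ ≡ secret G x₂

-- Quotient automaton of G modulo ∼, presented as a setoid: a class [x] is
-- represented by any of its members x; ([x],σ,[y]) is a transition iff
-- x' --σ--> y' for some x' ∼ x, y' ∼ y; [x] is initial iff x ∼ x° for some
-- initial x°; [x] is secret iff x is secret (well defined by (ii)).
quotient : ∀ {E : Set} (G : Automaton E) (_∼_ : State G → State G → Set) → Automaton E
quotient G _∼_ = record
  { State  = State G
  ; alph   = alph G
  ; Trans  = λ x σ y → ∃[ x' ] ∃[ y' ] (x ∼ x' × y ∼ y' × Trans G x' σ y')
  ; Init   = λ x → ∃[ x₀ ] (Init G x₀ × x ∼ x₀)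
  ; secret = secret G
  }

LocalMove : ∀ {E : Set} {n} (G : Fin n → Automaton E) →
            ((i : Fin n) → State (G i)) → E → ((i : Fin n) → State (G i)) → Fin n → Set
LocalMove G x e y i = if alph (G i) e then Trans (G i) (x i) (just e) (y i) else (y i ≡ x i)

compose : ∀ {E : Set} {n} → (Fin n → Automaton E) → Automaton E
compose {E} {n} G = record
  { State  = (i : Fin n) → State (G i)
  ; alph   = λ e → any (λ i → alph (G i) e) (allFin n)
  ; Trans  = step
  ; Init   = λ x → (i : Fin n) → Init (G i) (x i)
  ; secret = λ x → any (λ i → secret (G i) (x i)) (allFin n)
  }
  where
  step : ((i : Fin n) → State (G i)) → Label E → ((i : Fin n) → State (G i)) → Set
  step x nothing  y = ∃[ i ] (Trans (G i) (x i) nothing (y i) × (∀ j → ¬ (j ≡ i) → y j ≡ x j))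
  step x (just e) y = (∃[ i ] (alph (G i) e ≡ true)) × (∀ i → LocalMove G x e y i)

replaceFirst : ∀ {E : Set} {n} → (Fin (suc n) → Automaton E) → Automaton E → Fin (suc n) → Automaton E
replaceFirst G H zero    = H
replaceFirst G H (suc i) = G (suc i)

module Submission where

-- The proof goes through one notion, an *opaque step bisimulation* R
-- between two automata: R relates initial states in both directions,
-- every strong step of either side is matched along R by a weak step of
-- the other side carrying the same observation, and related states agree
-- on secrecy.

open import Defs
open import Data.Nat using (ℕ; suc)
open import Data.Fin using (Fin; zero; suc)
open import Data.Fin.Properties using (suc-injective)
open import Data.Empty using (⊥-elim)
open import Data.Bool using (Bool; true; false; _∨_; if_then_else_)
open import Data.Bool.ListAction using (or)
open import Data.List using (List; []; _∷_; _++_; tabulate)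
open import Data.List.Properties using (∷-injective; tabulate-cong; map-tabulate)
open import Data.Maybe using (just; nothing)
open import Data.Product using (_×_; ∃-syntax; _,_)
open import Data.Sum using (_⊎_; inj₁; inj₂)
open import Relation.Nullary using (¬_)
open import Relation.Binary using (IsEquivalence)
open import Relation.Binary.PropositionalEquality
  using (_≡_; refl; sym; trans; cong; cong₂; subst; module ≡-Reasoning)
open import Function using (_∘_; flip)

if-elim : ∀ {P Q : Set} b → (if b then P else Q) → (b ≡ true × P) ⊎ (b ≡ false × Q)
if-elim true p = inj₁ (refl , p)
if-elim false q = inj₂ (refl , q)

if-true : ∀ {P Q : Set} {b} → b ≡ true → P → if b then P else Q
if-true refl p = p

if-false : ∀ {P Q : Set} {b} → b ≡ false → Q → if b then P else Q
if-false refl q = q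

module _ {E : Set} where

  erase-++ : (t u : List (Label E)) → erase (t ++ u) ≡ erase t ++ erase u
  erase-++ [] u = refl
  erase-++ (nothing ∷ t) u = erase-++ t u
  erase-++ (just e ∷ t) u = cong (e ∷_) (erase-++ t u)

  module _ (A : Automaton E) where

    path-++ : ∀ {p q r t u} → Path A p t q → Path A q u r → Path A p (t ++ u) r
    path-++ nil q = q
    path-++ (cons tr p) q = cons tr (path-++ p q)

    weak-refl : ∀ {p} → Weak A p [] p
    weak-refl = [] , refl , nil

    weak-++ : ∀ {p q r s s'} → Weak A p s q → Weak A q s' r → Weak A p (s ++ s') r
    weak-++ (t , refl , p) (u , refl , q) = t ++ u , erase-++ t u , path-++ p q

    weak-step : ∀ {p σ q} → Trans A p σ q → Weak A p (erase (σ ∷ [])) q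
    weak-step {σ = σ} tr = σ ∷ [] , refl , cons tr nil

    split-event : ∀ {p q e} → Weak A p (e ∷ []) q →
      ∃[ p' ] ∃[ q' ] (Weak A p [] p' × Trans A p' (just e) q' × Weak A q' [] q)
    split-event ([] , () , _)
    split-event (nothing ∷ t , eq , cons tr run) with split-event (t , eq , run)
    ... | p' , q' , (u , eu , pre) , tr' , post =
      p' , q' , (nothing ∷ u , eu , cons tr pre) , tr' , post
    split-event (just _ ∷ t , eq , cons tr run) with ∷-injective eq
    ... | refl , et = _ , _ , weak-refl , tr , (t , et , run)

  StepSim : (A B : Automaton E) → (State A → State B → Set) → Set
  StepSim A B R = ∀ {x y σ y'} → R x y → Trans B y σ y' →
    ∃[ x' ] (Weak A x (erase (σ ∷ [])) x' × R x' y')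

  WeakSim : (A B : Automaton E) → (State A → State B → Set) → Set
  WeakSim A B R = ∀ {x y s y'} → R x y → Weak B y s y' → ∃[ x' ] (Weak A x s x' × R x' y')

  weak-simulation : ∀ {A B R} → StepSim A B R → WeakSim A B R
  weak-simulation {A} {B} {R} sim r (t , refl , run) = along r run
    where
    along : ∀ {x y t y'} → R x y → Path B y t y' → ∃[ x' ] (Weak A x (erase t) x' × R x' y')
    along r nil = _ , weak-refl A , r
    along r (cons {σ = σ} {t = t} tr run) =
      let (x₁ , w₁ , r₁) = sim r tr
          (x₂ , w₂ , r₂) = along r₁ run
      in x₂ , subst (λ s → Weak A _ s x₂) (sym (erase-++ (σ ∷ []) t)) (weak-++ A w₁ w₂) , r₂

  record OpaqueStepBisim (A B : Automaton E) (R : State A → State B → Set) : Set where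
    field
      init-AB   : ∀ {x} → Init A x → ∃[ y ] (Init B y × R x y)
      init-BA   : ∀ {y} → Init B y → ∃[ x ] (Init A x × R x y)
      sim-BA    : StepSim A B R
      sim-AB    : StepSim B A (flip R)
      secret-eq : ∀ {x y} → R x y → secret A x ≡ secret B y

  flip-bisim : ∀ {A B R} → OpaqueStepBisim A B R → OpaqueStepBisim B A (flip R)
  flip-bisim b = record
    { init-AB = init-BA ; init-BA = init-AB ; sim-BA = sim-AB ; sim-AB = sim-BA
    ; secret-eq = λ r → sym (secret-eq r) }
    where open OpaqueStepBisim b

  -- Infinite-step opacity transfers along an opaque step bisimulation: a
  -- secret-revealing run of B is matched by a run of A, A supplies a
  -- non-secret run with the same observations, and B matches it back.
  opacity-transfer : ∀ {A B R} → OpaqueStepBisim A B R →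
    InfiniteStepOpaque A → InfiniteStepOpaque B
  opacity-transfer {A} {B} b opaqueA y₀ s t iy₀ (_ , wst) (ys , ws , ys-secret) =
    let (x₀ , ix₀ , r₀) = init-BA iy₀
        (_ , wstA , _) = runA r₀ wst
        (xs , wsA , rs) = runA r₀ ws
        (x₀' , x , ix₀' , wx , x-public , z , wz) =
          opaqueA x₀ s t ix₀ (_ , wstA) (xs , wsA , trans (secret-eq rs) ys-secret)
        (y₀' , iy₀' , r₀') = init-AB ix₀'
        (y , wy , r) = runB r₀' wx
        (z' , wz' , _) = runB r wz
    in y₀' , y , iy₀' , wy , trans (sym (secret-eq r)) x-public , z' , wz'
    where
    open OpaqueStepBisim b
    runA : WeakSim A B _
    runA = weak-simulation sim-BA
    runB : WeakSim B A _
    runB = weak-simulation sim-AB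

  quotient-bisim : ∀ {G : Automaton E} {_∼_} → IsOpaqueObsEquiv G _∼_ →
    OpaqueStepBisim G (quotient G _∼_) _∼_
  quotient-bisim {G} {_∼_} oe = record
    { init-AB = λ {x} ix → x , (x , ix , ∼-refl) , ∼-refl
    ; init-BA = λ { (x₀ , ix₀ , y∼x₀) → x₀ , ix₀ , ∼-sym y∼x₀ }
    ; sim-BA = quotient-step-by-weak
    ; sim-AB = step-in-quotient
    ; secret-eq = secretResp
    }
    where
    open IsOpaqueObsEquiv oe
    open IsEquivalence isEquivalence renaming (refl to ∼-refl; sym to ∼-sym; trans to ∼-trans)
    -- A quotient step [x'] --σ--> [y'] is realised by x' --σ--> y' in G,
    -- and ∼ transports it to a weak step of any x ∼ x'.
    quotient-step-by-weak : StepSim G (quotient G _∼_) _∼_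
    quotient-step-by-weak x∼y (a , b , y∼a , y'∼b , tr)
      with simulate (∼-sym (∼-trans x∼y y∼a)) (weak-step G tr)
    ... | c , wc , b∼c = c , wc , ∼-sym (∼-trans y'∼b b∼c)
    step-in-quotient : StepSim (quotient G _∼_) G (flip _∼_)
    step-in-quotient {x = y} {y = x} {y' = x'} x∼y tr =
      x' , weak-step (quotient G _∼_) (x , x' , ∼-sym x∼y , ∼-refl , tr) , ∼-refl

  module _ {n : ℕ} where

    Tail : (Fin n → Automaton E) → Set
    Tail T = (k : Fin n) → State (T k)

    _≐_ : ∀ {B : Fin n → Set} → ((k : Fin n) → B k) → ((k : Fin n) → B k) → Set
    s ≐ t = ∀ k → s k ≡ t k

    TailTau : (T : Fin n → Automaton E) → Tail T → Tail T → Set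
    TailTau T s t = ∃[ k ] (Trans (T k) (s k) nothing (t k) × (∀ j → ¬ j ≡ k → t j ≡ s j))

    TailEvent : (T : Fin n → Automaton E) → Tail T → E → Tail T → Set
    TailEvent T s e t = ∀ k → if alph (T k) e then Trans (T k) (s k) (just e) (t k) else t k ≡ s k

    TailActive : (Fin n → Automaton E) → E → Set
    TailActive T e = ∃[ k ] (alph (T k) e ≡ true)

    tail-secret : (T : Fin n → Automaton E) → Tail T → Bool
    tail-secret T s = or (tabulate (λ k → secret (T k) (s k)))

    tail-secret-resp : ∀ {T s₁ s₂} → s₁ ≐ s₂ → tail-secret T s₁ ≡ tail-secret T s₂
    tail-secret-resp {T} eq = cong or (tabulate-cong (λ k → cong (secret (T k)) (eq k)))

    tail-tau-resp : ∀ {T s₁ s₂ t} → s₁ ≐ s₂ → TailTau T s₂ t → TailTau T s₁ t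
    tail-tau-resp {T} {t = t} eq (k , tr , frame) =
      k , subst (λ z → Trans (T k) z nothing (t k)) (sym (eq k)) tr ,
      λ j j≢k → trans (frame j j≢k) (sym (eq j))

    tail-event-resp : ∀ {T s₁ s₂ e t} → s₁ ≐ s₂ → TailEvent T s₂ e t → TailEvent T s₁ e t
    tail-event-resp {T} {e = e} {t} eq moves k =
      subst (λ z → if alph (T k) e then Trans (T k) z (just e) (t k) else t k ≡ z)
            (sym (eq k)) (moves k)

    data BlockStep (K : Automaton E) (T : Fin n → Automaton E) :
        State K → Tail T → Label E → State K → Tail T → Set where
      head-τ : ∀ {h s h' s'} → Trans K h nothing h' → s' ≐ s → BlockStep K T h s nothing h' s'
      tail-τ : ∀ {h s h' s'} → h' ≡ h → TailTau T s s' → BlockStep K T h s nothing h' s'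
      sync   : ∀ {h s e h' s'} → alph K e ≡ true → Trans K h (just e) h' →
               TailEvent T s e s' → BlockStep K T h s (just e) h' s'
      idle   : ∀ {h s e h' s'} → alph K e ≡ false → h' ≡ h → TailActive T e →
               TailEvent T s e s' → BlockStep K T h s (just e) h' s'

    -- The same shapes, with the head moving weakly; these are exactly the
    -- moves that reassemble into a weak step of the composition.
    data BlockWeak (K : Automaton E) (T : Fin n → Automaton E) :
        State K → Tail T → Label E → State K → Tail T → Set where
      head-τ* : ∀ {h s h'} → Weak K h [] h' → BlockWeak K T h s nothing h' s
      tail-τ  : ∀ {h s s'} → TailTau T s s' → BlockWeak K T h s nothing h s'
      sync    : ∀ {h s e h' s'} → alph K e ≡ true → Weak K h (e ∷ []) h' →
                TailEvent T s e s' → BlockWeak K T h s (just e) h' s'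
      idle    : ∀ {h s e s'} → alph K e ≡ false → TailActive T e →
                TailEvent T s e s' → BlockWeak K T h s (just e) h s'

    block-simulation : ∀ {K₁ K₂ : Automaton E} {T ρ} →
      (∀ e → alph K₁ e ≡ alph K₂ e) → StepSim K₁ K₂ ρ →
      ∀ {h₁ h₂ s₁ s₂ σ h₂' s₂'} → ρ h₁ h₂ → s₁ ≐ s₂ → BlockStep K₂ T h₂ s₂ σ h₂' s₂' →
      ∃[ h₁' ] ∃[ s₁' ] (BlockWeak K₁ T h₁ s₁ σ h₁' s₁' × ρ h₁' h₂' × s₁' ≐ s₂')
    block-simulation same sim r eq (head-τ tr eq') =
      let (h₁' , w , r') = sim r tr
      in h₁' , _ , head-τ* w , r' , λ k → trans (eq k) (sym (eq' k))
    block-simulation {T = T} same sim r eq (tail-τ refl moves) =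
      _ , _ , tail-τ (tail-tau-resp {T = T} eq moves) , r , λ _ → refl
    block-simulation {T = T} same sim r eq (sync {e = e} on tr moves) =
      let (h₁' , w , r') = sim r tr
      in h₁' , _ , sync (trans (same e) on) w (tail-event-resp {T = T} eq moves) , r' , λ _ → refl
    block-simulation {T = T} same sim r eq (idle {e = e} off refl active moves) =
      _ , _ , idle (trans (same e) off) active (tail-event-resp {T = T} eq moves) , r , λ _ → refl

  module _ {n : ℕ} (F : Fin (suc n) → Automaton E) where

    tail : State (compose F) → Tail (F ∘ suc)
    tail x k = x (suc k)

    _◂_ : State (F zero) → Tail (F ∘ suc) → State (compose F)
    (h ◂ t) zero = h
    (h ◂ t) (suc k) = t k

    Splits : State (compose F) → State (F zero) → Tail (F ∘ suc) → Set
    Splits x h t = x zero ≡ h × tail x ≐ t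

    view : ∀ {x σ x'} → Trans (compose F) x σ x' →
      BlockStep (F zero) (F ∘ suc) (x zero) (tail x) σ (x' zero) (tail x')
    view {σ = nothing} (zero , tr , frame) = head-τ tr (λ k → frame (suc k) λ ())
    view {σ = nothing} (suc k , tr , frame) =
      tail-τ (frame zero λ ()) (k , tr , λ j j≢k → frame (suc j) (j≢k ∘ suc-injective))
    view {σ = just e} (active , moves) with if-elim (alph (F zero) e) (moves zero)
    ... | inj₁ (on , tr) = sync on tr (λ k → moves (suc k))
    ... | inj₂ (off , stay) = idle off stay (active-in-tail active) (λ k → moves (suc k))
      where
      active-in-tail : ∃[ i ] (alph (F i) e ≡ true) → TailActive (F ∘ suc) e
      active-in-tail (zero , on) with trans (sym off) on
      ... | ()
      active-in-tail (suc k , on) = k , on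

    head-τ-step : ∀ {x h} → Trans (F zero) (x zero) nothing h →
      Trans (compose F) x nothing (h ◂ tail x)
    head-τ-step tr = zero , tr , λ { zero 0≢0 → ⊥-elim (0≢0 refl) ; (suc k) _ → refl }

    tail-τ-step : ∀ {x t} → TailTau (F ∘ suc) (tail x) t →
      Trans (compose F) x nothing (x zero ◂ t)
    tail-τ-step (k , tr , frame) =
      suc k , tr , λ { zero _ → refl ; (suc j) j≢k → frame j (j≢k ∘ cong suc) }

    sync-step : ∀ {x e h t} → alph (F zero) e ≡ true → Trans (F zero) (x zero) (just e) h →
      TailEvent (F ∘ suc) (tail x) e t → Trans (compose F) x (just e) (h ◂ t)
    sync-step on tr moves = (zero , on) , λ { zero → if-true on tr ; (suc k) → moves k }

    idle-step : ∀ {x e t} → alph (F zero) e ≡ false → TailActive (F ∘ suc) e →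
      TailEvent (F ∘ suc) (tail x) e t → Trans (compose F) x (just e) (x zero ◂ t)
    idle-step off (k , on) moves =
      (suc k , on) , λ { zero → if-false off refl ; (suc j) → moves j }

    lift-head-silent : ∀ x {h} → Weak (F zero) (x zero) [] h →
      ∃[ x' ] (Weak (compose F) x [] x' × Splits x' h (tail x))
    lift-head-silent x (t , silent , run) = along x run silent
      where
      along : ∀ x {t h} → Path (F zero) (x zero) t h → erase t ≡ [] →
        ∃[ x' ] (Weak (compose F) x [] x' × Splits x' h (tail x))
      along x nil _ = x , weak-refl _ , refl , λ _ → refl
      along x (cons {σ = nothing} tr run) silent =
        let (x' , w , split) = along _ run silent
        in x' , weak-++ _ (weak-step _ {σ = nothing} (head-τ-step tr)) w , split
      along x (cons {σ = just _} _ _) ()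

    assemble : ∀ {x σ h t} → BlockWeak (F zero) (F ∘ suc) (x zero) (tail x) σ h t →
      ∃[ x' ] (Weak (compose F) x (erase (σ ∷ [])) x' × Splits x' h t)
    assemble (head-τ* w) = lift-head-silent _ w
    assemble {x} (tail-τ moves) =
      _ , weak-step _ {σ = nothing} (tail-τ-step {x} moves) , refl , λ _ → refl
    assemble {x} (idle {e = e} off active moves) =
      _ , weak-step _ {σ = just e} (idle-step {x} off active moves) , refl , λ _ → refl
    assemble {x} {t = t} (sync {e = e} on w moves) =
      let (p , q , pre , tr , post) = split-event _ w
          (x₁ , w₁ , p≡ , tail≐) = lift-head-silent x pre
          tr₁ = subst (λ z → Trans (F zero) z (just e) q) (sym p≡) tr
          step = sync-step {x₁} on tr₁ (tail-event-resp {T = F ∘ suc} tail≐ moves)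
          (x₂ , w₂ , split) = lift-head-silent (q ◂ t) post
      in x₂ , weak-++ _ w₁ (weak-++ _ (weak-step _ {σ = just e} step) w₂) , split

    secret-split : ∀ x →
      secret (compose F) x ≡ secret (F zero) (x zero) ∨ tail-secret (F ∘ suc) (tail x)
    secret-split x =
      cong (λ l → secret (F zero) (x zero) ∨ or l) (map-tabulate suc (λ i → secret (F i) (x i)))

    init-join : ∀ {h t} → Init (F zero) h → (∀ k → Init (F (suc k)) (t k)) →
      Init (compose F) (h ◂ t)
    init-join ih it zero = ih
    init-join ih it (suc k) = it k

  module _ {n : ℕ} (G : Fin (suc n) → Automaton E) (H : Automaton E)
           (ρ : State (G zero) → State H → Set) where

    private
      G' : Fin (suc n) → Automaton E
      G' = replaceFirst G H

    HeadRel : State (compose G) → State (compose G') → Set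
    HeadRel x y = ρ (x zero) (y zero) × tail G x ≐ tail G' y

    compose-bisim : (∀ e → alph (G zero) e ≡ alph H e) → OpaqueStepBisim (G zero) H ρ →
      OpaqueStepBisim (compose G) (compose G') HeadRel
    compose-bisim same b = record
      { init-AB = init-G→G' ; init-BA = init-G'→G
      ; sim-BA = G-matches-G' ; sim-AB = G'-matches-G ; secret-eq = same-secret }
      where
      open OpaqueStepBisim b

      init-G→G' : ∀ {x} → Init (compose G) x → ∃[ y ] (Init (compose G') y × HeadRel x y)
      init-G→G' {x} ix =
        let (h , ih , r) = init-AB (ix zero)
        in _◂_ G' h (tail G x) , init-join G' ih (λ k → ix (suc k)) , r , λ _ → refl

      init-G'→G : ∀ {y} → Init (compose G') y → ∃[ x ] (Init (compose G) x × HeadRel x y)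
      init-G'→G {y} iy =
        let (h , ih , r) = init-BA (iy zero)
        in _◂_ G h (tail G' y) , init-join G ih (λ k → iy (suc k)) , r , λ _ → refl

      -- View the step of one composition as a block step, match it in the
      -- head with b, and reassemble on the other side.
      G-matches-G' : StepSim (compose G) (compose G') HeadRel
      G-matches-G' (r , eq) tr =
        let (_ , _ , moves , r' , eq') = block-simulation same sim-BA r eq (view G' tr)
            (x' , w , h≡ , t≐) = assemble G moves
        in x' , w , subst (λ z → ρ z _) (sym h≡) r' , λ k → trans (t≐ k) (eq' k)

      G'-matches-G : StepSim (compose G') (compose G) (flip HeadRel)
      G'-matches-G (r , eq) tr =
        let (_ , _ , moves , r' , eq') = block-simulation (sym ∘ same) sim-AB r (sym ∘ eq) (view G tr)
            (y' , w , h≡ , t≐) = assemble G' moves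
        in y' , w , subst (ρ _) (sym h≡) r' , λ k → sym (trans (t≐ k) (eq' k))

      same-secret : ∀ {x y} → HeadRel x y → secret (compose G) x ≡ secret (compose G') y
      same-secret {x} {y} (r , eq) = begin
        secret (compose G) x
          ≡⟨ secret-split G x ⟩
        secret (G zero) (x zero) ∨ tail-secret (G ∘ suc) (tail G x)
          ≡⟨ cong₂ _∨_ (secret-eq r) (tail-secret-resp {T = G ∘ suc} eq) ⟩
        secret H (y zero) ∨ tail-secret (G ∘ suc) (tail G' y)
          ≡⟨ sym (secret-split G' y) ⟩
        secret (compose G') y ∎
        where open ≡-Reasoning

theorem4 : {E : Set} → Finite E → (n : ℕ) → (G : Fin (suc n) → Automaton E) →
    ((i : Fin (suc n)) → Finite (State (G i))) → ((i : Fin (suc n)) → WellFormed (G i)) →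
    (_∼_ : State (G zero) → State (G zero) → Set) → IsOpaqueObsEquiv (G zero) _∼_ →
    (InfiniteStepOpaque (compose G) → InfiniteStepOpaque (compose (replaceFirst G (quotient (G zero) _∼_))))
    × (InfiniteStepOpaque (compose (replaceFirst G (quotient (G zero) _∼_))) → InfiniteStepOpaque (compose G))
theorem4 _ n G _ _ _∼_ oe = opacity-transfer composite , opacity-transfer (flip-bisim composite)
  where
  composite : OpaqueStepBisim (compose G) (compose (replaceFirst G (quotient (G zero) _∼_))) (HeadRel G _ _∼_)
  composite = compose-bisim G (quotient (G zero) _∼_) _∼_ (λ _ → refl) (quotient-bisim oe)
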